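{- For any $B$-terms $e_1$ and $e_2$ there exists an integer $k\ge0$ such that $e_1\circ(B\,e_2)$ is $\beta\eta$-equivalent to $B\,(e_1\,e_2)\circ B^k$, where $B^k$ denotes the $k$-fold composition $B\circ\cdots\circ B$ and, for $k=0$, $B(e_1e_2)\circ B^0$ is read as $B\,(e_1\,e_2)$.
   Context: $B=\lambda f.\lambda g.\lambda x.\, f\,(g\,x)$. A $B$-term is a combinatory term built from $B$ alone by application; equality of $B$-terms is $\beta\eta$-equivalence of their associated $\lambda$-terms. $e_1\circ e_2$ denotes $B\,e_1\,e_2$. -}

module Defs where

open import Data.Nat using (ℕ; zero; suc)

data Λ : Set where
  var : ℕ → Λ
  lam : Λ → Λ
  app : Λ → Λ → Λ

ext : (ℕ → ℕ) → ℕ → ℕ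
ext ρ zero    = zero
ext ρ (suc n) = suc (ρ n)

rename : (ℕ → ℕ) → Λ → Λ
rename ρ (var n)   = var (ρ n)
rename ρ (lam M)   = lam (rename (ext ρ) M)
rename ρ (app M N) = app (rename ρ M) (rename ρ N)

exts : (ℕ → Λ) → ℕ → Λ
exts σ zero    = var zero
exts σ (suc n) = rename suc (σ n)

subst : (ℕ → Λ) → Λ → Λ
subst σ (var n)   = σ n
subst σ (lam M)   = lam (subst (exts σ) M)
subst σ (app M N) = app (subst σ M) (subst σ N)

sub0 : Λ → ℕ → Λ
sub0 N zero    = N
sub0 N (suc n) = var n

_[_] : Λ → Λ → Λ
M [ N ] = subst (sub0 N) M

infix 4 _≃βη_
data _≃βη_ : Λ → Λ → Set where
  β     : ∀ M N → app (lam M) N ≃βη M [ N ]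
  η     : ∀ M → lam (app (rename suc M) (var zero)) ≃βη M
  refl  : ∀ {M} → M ≃βη M
  sym   : ∀ {M N} → M ≃βη N → N ≃βη M
  trans : ∀ {M N P} → M ≃βη N → N ≃βη P → M ≃βη P
  app-cong : ∀ {M M′ N N′} → M ≃βη M′ → N ≃βη N′ → app M N ≃βη app M′ N′
  lam-cong : ∀ {M M′} → M ≃βη M′ → lam M ≃βη lam M′

infixl 9 _·_
data BTerm : Set where
  B   : BTerm
  _·_ : BTerm → BTerm → BTerm

-- associated λ-term; B = λf.λg.λx. f (g x)
⟦_⟧ : BTerm → Λ
⟦ B ⟧     = lam (lam (lam (app (var 2) (app (var 1) (var 0)))))
⟦ e · f ⟧ = app ⟦ e ⟧ ⟦ f ⟧

infix 4 _≈_
_≈_ : BTerm → BTerm → Set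
e ≈ f = ⟦ e ⟧ ≃βη ⟦ f ⟧

infixr 8 _∘_
_∘_ : BTerm → BTerm → BTerm
e₁ ∘ e₂ = B · e₁ · e₂

Bpow+1 : ℕ → BTerm
Bpow+1 zero    = B
Bpow+1 (suc n) = B ∘ Bpow+1 n

-- B e ∘ B^k, read as B e when k = 0
B-comp-pow : BTerm → ℕ → BTerm
B-comp-pow e zero    = B · e
B-comp-pow e (suc n) = (B · e) ∘ Bpow+1 n

-- Every B-term βη-reduces either to B, to B a, to B a b, or to a strictly
-- smaller B-term, so it suffices to treat those three shapes, by induction on
-- size. B ∘ B e₂ = B (B e₂) ∘ B and B a ∘ B e₂ = B (B a e₂) directly; for
-- B a b, associativity gives B a b ∘ B e₂ = a ∘ (b ∘ B e₂), and the claims for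
-- b and then a push B e₂ outwards, the powers of B collecting on the right.
module Submission where

open import Defs
open import Data.Nat using (ℕ; zero; suc; _+_; _<_; s≤s)
open import Data.Nat.Properties using (+-assoc; +-suc; ≤-reflexive; m≤m+n; m≤n+m; +-monoˡ-<)
open import Data.Nat.Induction using (<-wellFounded)
open import Data.Product using (Σ; _,_)
open import Function using (_on_)
open import Induction.WellFounded using (Acc; acc)
open import Relation.Binary.Bundles using (Setoid)
import Relation.Binary.Reasoning.Setoid as SetoidReasoning
open import Relation.Binary.Construct.On as On using ()
open import Relation.Binary.PropositionalEquality as ≡ using (_≡_; cong; cong₂)

subst-cong : ∀ {σ τ} → (∀ n → σ n ≡ τ n) → ∀ M → subst σ M ≡ subst τ M
subst-cong σ≡τ (var n)   = σ≡τ n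
subst-cong σ≡τ (lam M)   = cong lam (subst-cong exts≡ M)
  where
  exts≡ : ∀ n → exts _ n ≡ exts _ n
  exts≡ zero    = ≡.refl
  exts≡ (suc n) = cong (rename suc) (σ≡τ n)
subst-cong σ≡τ (app M N) = cong₂ app (subst-cong σ≡τ M) (subst-cong σ≡τ N)

subst-rename : ∀ σ ρ M → subst σ (rename ρ M) ≡ subst (λ n → σ (ρ n)) M
subst-rename σ ρ (var n)   = ≡.refl
subst-rename σ ρ (lam M)   =
  cong lam (≡.trans (subst-rename (exts σ) (ext ρ) M) (subst-cong exts-ext M))
  where
  exts-ext : ∀ n → exts σ (ext ρ n) ≡ exts (λ n → σ (ρ n)) n
  exts-ext zero    = ≡.refl
  exts-ext (suc n) = ≡.refl
subst-rename σ ρ (app M N) = cong₂ app (subst-rename σ ρ M) (subst-rename σ ρ N)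

subst-var≡rename : ∀ {σ ρ} → (∀ n → σ n ≡ var (ρ n)) → ∀ M → subst σ M ≡ rename ρ M
subst-var≡rename σ≡ρ (var n)   = σ≡ρ n
subst-var≡rename σ≡ρ (lam M)   = cong lam (subst-var≡rename exts≡ext M)
  where
  exts≡ext : ∀ n → exts _ n ≡ var (ext _ n)
  exts≡ext zero    = ≡.refl
  exts≡ext (suc n) = cong (rename suc) (σ≡ρ n)
subst-var≡rename σ≡ρ (app M N) = cong₂ app (subst-var≡rename σ≡ρ M) (subst-var≡rename σ≡ρ N)

subst-id : ∀ {σ} → (∀ n → σ n ≡ var n) → ∀ M → subst σ M ≡ M
subst-id σ≡var (var n)   = σ≡var n
subst-id σ≡var (lam M)   = cong lam (subst-id exts≡var M)
  where
  exts≡var : ∀ n → exts _ n ≡ var n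
  exts≡var zero    = ≡.refl
  exts≡var (suc n) = cong (rename suc) (σ≡var n)
subst-id σ≡var (app M N) = cong₂ app (subst-id σ≡var M) (subst-id σ≡var N)

rename-suc-[] : ∀ M N → rename suc M [ N ] ≡ M
rename-suc-[] M N = ≡.trans (subst-rename (sub0 N) suc M) (subst-id (λ _ → ≡.refl) M)

subst-exts-sub0-rename-suc² : ∀ N M →
  subst (exts (sub0 N)) (rename suc (rename suc M)) ≡ rename suc M
subst-exts-sub0-rename-suc² N M =
  ≡.trans (subst-rename (exts (sub0 N)) suc (rename suc M))
    (≡.trans (subst-rename _ suc M) (subst-var≡rename (λ _ → ≡.refl) M))

⟦⟧-rename : ∀ ρ e → rename ρ ⟦ e ⟧ ≡ ⟦ e ⟧
⟦⟧-rename ρ B       = ≡.refl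
⟦⟧-rename ρ (e · f) = cong₂ app (⟦⟧-rename ρ e) (⟦⟧-rename ρ f)

≡⇒≃βη : ∀ {M N} → M ≡ N → M ≃βη N
≡⇒≃βη ≡.refl = refl

≃βη-setoid : Setoid _ _
≃βη-setoid = record
  { Carrier       = Λ
  ; _≈_           = _≃βη_
  ; isEquivalence = record { refl = refl ; sym = sym ; trans = trans }
  }

≈-setoid : Setoid _ _
≈-setoid = record
  { Carrier       = BTerm
  ; _≈_           = _≈_
  ; isEquivalence = record { refl = refl ; sym = sym ; trans = trans }
  }

module ≃βη-Reasoning = SetoidReasoning ≃βη-setoid
module ≈-Reasoning = SetoidReasoning ≈-setoid

B-β : ∀ f g x → app (app (app ⟦ B ⟧ f) g) x ≃βη app f (app g x)
B-β f g x = begin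
  app (app (app ⟦ B ⟧ f) g) x
    ≈⟨ app-cong (app-cong (β _ f) refl) refl ⟩
  app (app (lam (lam (app (rename suc (rename suc f)) (app (var 1) (var 0))))) g) x
    ≈⟨ app-cong (β _ g) refl ⟩
  app (lam (app (subst (exts (sub0 g)) (rename suc (rename suc f))) (app (rename suc g) (var 0)))) x
    ≈⟨ app-cong (lam-cong (≡⇒≃βη (cong (λ t → app t _) (subst-exts-sub0-rename-suc² g f)))) refl ⟩
  app (lam (app (rename suc f) (app (rename suc g) (var 0)))) x
    ≈⟨ β _ x ⟩
  app (rename suc f [ x ]) (app (rename suc g [ x ]) x)
    ≡⟨ cong₂ (λ s t → app s (app t x)) (rename-suc-[] f x) (rename-suc-[] g x) ⟩
  app f (app g x) ∎
  where open ≃βη-Reasoning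

η-ext : ∀ {M N M′ N′} → rename suc M ≡ M′ → rename suc N ≡ N′ →
  app M′ (var 0) ≃βη app N′ (var 0) → M ≃βη N
η-ext {M} {N} ≡.refl ≡.refl M0≃N0 = trans (sym (η M)) (trans (lam-cong M0≃N0) (η N))

≈-ext₁ : ∀ e f → app ⟦ e ⟧ (var 0) ≃βη app ⟦ f ⟧ (var 0) → e ≈ f
≈-ext₁ e f = η-ext (⟦⟧-rename suc e) (⟦⟧-rename suc f)

≈-ext₂ : ∀ e f →
  app (app ⟦ e ⟧ (var 1)) (var 0) ≃βη app (app ⟦ f ⟧ (var 1)) (var 0) → e ≈ f
≈-ext₂ e f exf = ≈-ext₁ e f (η-ext (cong (λ t → app t (var 1)) (⟦⟧-rename suc e))
                                   (cong (λ t → app t (var 1)) (⟦⟧-rename suc f)) exf)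

≈-ext₃ : ∀ e f →
  app (app (app ⟦ e ⟧ (var 2)) (var 1)) (var 0) ≃βη app (app (app ⟦ f ⟧ (var 2)) (var 1)) (var 0) →
  e ≈ f
≈-ext₃ e f exf = ≈-ext₂ e f (η-ext (cong (λ t → app (app t (var 2)) (var 1)) (⟦⟧-rename suc e))
                                   (cong (λ t → app (app t (var 2)) (var 1)) (⟦⟧-rename suc f)) exf)

B-reduce : ∀ a b c → B · a · b · c ≈ a · (b · c)
B-reduce a b c = B-β ⟦ a ⟧ ⟦ b ⟧ ⟦ c ⟧

∘-cong : ∀ {a a′ b b′} → a ≈ a′ → b ≈ b′ → a ∘ b ≈ a′ ∘ b′
∘-cong a≈a′ b≈b′ = app-cong (app-cong refl a≈a′) b≈b′

∘-assoc : ∀ a b c → (a ∘ b) ∘ c ≈ a ∘ (b ∘ c)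
∘-assoc a b c = ≈-ext₁ ((a ∘ b) ∘ c) (a ∘ (b ∘ c)) (begin
  app ⟦ (a ∘ b) ∘ c ⟧ x                   ≈⟨ B-β _ _ x ⟩
  app ⟦ a ∘ b ⟧ (app ⟦ c ⟧ x)             ≈⟨ B-β _ _ _ ⟩
  app ⟦ a ⟧ (app ⟦ b ⟧ (app ⟦ c ⟧ x))     ≈⟨ app-cong refl (B-β _ _ x) ⟨
  app ⟦ a ⟧ (app ⟦ b ∘ c ⟧ x)             ≈⟨ B-β _ _ x ⟨
  app ⟦ a ∘ (b ∘ c) ⟧ x                   ∎)
  where
  open ≃βη-Reasoning
  x = var 0

B·-∘-homo : ∀ a e → B · a ∘ B · e ≈ B · (a ∘ e)
B·-∘-homo a e = ≈-ext₂ (B · a ∘ B · e) (B · (a ∘ e)) (begin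
  app (app ⟦ B · a ∘ B · e ⟧ f) y           ≈⟨ app-cong (B-β _ _ f) refl ⟩
  app (app ⟦ B · a ⟧ (app ⟦ B · e ⟧ f)) y   ≈⟨ B-β _ _ y ⟩
  app ⟦ a ⟧ (app (app ⟦ B · e ⟧ f) y)       ≈⟨ app-cong refl (B-β _ _ y) ⟩
  app ⟦ a ⟧ (app ⟦ e ⟧ (app f y))           ≈⟨ B-β _ _ _ ⟨
  app ⟦ a ∘ e ⟧ (app f y)                   ≈⟨ B-β _ _ y ⟨
  app (app ⟦ B · (a ∘ e) ⟧ f) y             ∎)
  where
  open ≃βη-Reasoning
  f = var 1
  y = var 0

B∘B·≈B·B·∘B : ∀ e → B ∘ B · e ≈ B · (B · e) ∘ B
B∘B·≈B·B·∘B e = ≈-ext₃ (B ∘ B · e) (B · (B · e) ∘ B) (begin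
  app (app (app ⟦ B ∘ B · e ⟧ f) g) y             ≈⟨ app-cong (app-cong (B-β _ _ f) refl) refl ⟩
  app (app (app ⟦ B ⟧ (app ⟦ B · e ⟧ f)) g) y     ≈⟨ B-β _ g y ⟩
  app (app ⟦ B · e ⟧ f) (app g y)                 ≈⟨ B-β _ f _ ⟩
  app ⟦ e ⟧ (app f (app g y))                     ≈⟨ app-cong refl (B-β f g y) ⟨
  app ⟦ e ⟧ (app (app (app ⟦ B ⟧ f) g) y)           ≈⟨ B-β _ _ y ⟨
  app (app ⟦ B · e ⟧ (app (app ⟦ B ⟧ f) g)) y       ≈⟨ app-cong (B-β _ _ g) refl ⟨
  app (app (app ⟦ B · (B · e) ⟧ (app ⟦ B ⟧ f)) g) y ≈⟨ app-cong (app-cong (B-β _ _ f) refl) refl ⟨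
  app (app (app ⟦ B · (B · e) ∘ B ⟧ f) g) y         ∎)
  where
  open ≃βη-Reasoning
  f = var 2
  g = var 1
  y = var 0

B-comp-pow-cong : ∀ {x x′} k → x ≈ x′ → B-comp-pow x k ≈ B-comp-pow x′ k
B-comp-pow-cong zero    x≈x′ = app-cong refl x≈x′
B-comp-pow-cong (suc k) x≈x′ = ∘-cong (app-cong refl x≈x′) refl

Bpow+1-∘ : ∀ m n → Bpow+1 m ∘ Bpow+1 n ≈ Bpow+1 (suc (m + n))
Bpow+1-∘ zero    n = refl
Bpow+1-∘ (suc m) n = trans (∘-assoc B (Bpow+1 m) (Bpow+1 n)) (∘-cong refl (Bpow+1-∘ m n))

B-comp-pow-∘ : ∀ x k n → B-comp-pow x k ∘ Bpow+1 n ≈ B-comp-pow x (k + suc n)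
B-comp-pow-∘ x zero    n = refl
B-comp-pow-∘ x (suc m) n rewrite +-suc m n =
  trans (∘-assoc (B · x) (Bpow+1 m) (Bpow+1 n)) (∘-cong refl (Bpow+1-∘ m n))

Factorises : BTerm → Set
Factorises e = ∀ e₂ → Σ ℕ λ k → e ∘ B · e₂ ≈ B-comp-pow (e · e₂) k

Factorises-resp-≈ : ∀ {e e′} → e ≈ e′ → Factorises e′ → Factorises e
Factorises-resp-≈ {e} {e′} e≈e′ fe′ e₂ with fe′ e₂
... | k , h = k , (begin
  e ∘ B · e₂                 ≈⟨ ∘-cong e≈e′ refl ⟩
  e′ ∘ B · e₂                ≈⟨ h ⟩
  B-comp-pow (e′ · e₂) k     ≈⟨ B-comp-pow-cong k (app-cong e≈e′ refl) ⟨
  B-comp-pow (e · e₂) k      ∎)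
  where open ≈-Reasoning

Factorises-B : Factorises B
Factorises-B e₂ = 1 , B∘B·≈B·B·∘B e₂

Factorises-B· : ∀ a → Factorises (B · a)
Factorises-B· a e₂ = 0 , B·-∘-homo a e₂

∘-B-comp-pow : ∀ {a} → Factorises a → ∀ y j →
  Σ ℕ λ k → a ∘ B-comp-pow y j ≈ B-comp-pow (a · y) k
∘-B-comp-pow fa y zero = fa y
∘-B-comp-pow {a} fa y (suc n) with fa y
... | k , h = k + suc n , (begin
  a ∘ (B · y ∘ Bpow+1 n)              ≈⟨ ∘-assoc a (B · y) (Bpow+1 n) ⟨
  (a ∘ B · y) ∘ Bpow+1 n              ≈⟨ ∘-cong h refl ⟩
  B-comp-pow (a · y) k ∘ Bpow+1 n     ≈⟨ B-comp-pow-∘ (a · y) k n ⟩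
  B-comp-pow (a · y) (k + suc n)      ∎)
  where open ≈-Reasoning

Factorises-B·· : ∀ {a b} → Factorises a → Factorises b → Factorises (B · a · b)
Factorises-B·· {a} {b} fa fb e₂ with fb e₂
... | j , hb with ∘-B-comp-pow fa (b · e₂) j
... | k , ha = k , (begin
  (a ∘ b) ∘ B · e₂            ≈⟨ ∘-assoc a b (B · e₂) ⟩
  a ∘ (b ∘ B · e₂)            ≈⟨ ∘-cong refl hb ⟩
  a ∘ B-comp-pow (b · e₂) j   ≈⟨ ha ⟩
  B-comp-pow (a · (b · e₂)) k ≈⟨ B-comp-pow-cong k (B-reduce a b e₂) ⟨
  B-comp-pow ((a ∘ b) · e₂) k ∎)
  where open ≈-Reasoning

size : BTerm → ℕ
size B       = 1
size (e · f) = size e + size f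

data HeadView : BTerm → Set where
  head-B   : HeadView B
  head-B·  : ∀ a → HeadView (B · a)
  head-B·· : ∀ a b → HeadView (B · a · b)
  shrinks  : ∀ {e} e′ → e ≈ e′ → size e′ < size e → HeadView e

headView : ∀ e → HeadView e
headView B = head-B
headView (f · g) with headView f
... | head-B          = head-B· g
... | head-B· a       = head-B·· a g
... | head-B·· a b    = shrinks (a · (b · g)) (B-reduce a b g)
                          (s≤s (≤-reflexive (≡.sym (+-assoc (size a) (size b) (size g)))))
... | shrinks f′ f≈f′ f′<f = shrinks (f′ · g) (app-cong f≈f′ refl) (+-monoˡ-< (size g) f′<f)

factorises : ∀ e → Factorises e
factorises e = go e (On.wellFounded size <-wellFounded e)
  where
  go : ∀ e → Acc (_<_ on size) e → Factorises e
  go e (acc rec) with headView e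
  ... | head-B           = Factorises-B
  ... | head-B· a        = Factorises-B· a
  ... | head-B·· a b     = Factorises-B·· (go a (rec (s≤s (m≤m+n (size a) (size b)))))
                                          (go b (rec (s≤s (m≤n+m (size b) (size a)))))
  ... | shrinks e′ e≈e′ e′<e = Factorises-resp-≈ e≈e′ (go e′ (rec e′<e))

lemma3p1 : (e₁ e₂ : BTerm) →
    Σ ℕ (λ k → e₁ ∘ (B · e₂) ≈ B-comp-pow (e₁ · e₂) k)
lemma3p1 e₁ = factorises e₁
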